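{- For a connected finite simple graph $G$ with at least two vertices, the Connected-compelling chromatic number of $G$ is at least $\max\{\chi(G),\gamma_c(G)\}$ and at most $\chi(G)+\gamma_c(G)$.
   Context: A proper coloring partitions $V(G)$ into nonempty independent color classes; a rainbow committee (RC) is a set consisting of exactly one vertex of each color. A proper coloring is Connected-compelling if every RC induces a connected subgraph; the Connected-compelling chromatic number is the minimum number of colors in such a coloring. $\chi(G)$ is the chromatic number and $\gamma_c(G)$ is the connected domination number (minimum size of a dominating set inducing a connected subgraph). -}

module Defs where

open import Data.Nat using (ℕ; _≤_)
open import Data.Fin using (Fin)
open import Data.Fin.Subset using (Subset; _∈_; ∣_∣)
open import Data.Bool using (Bool; true; false)
open import Data.Product using (Σ; ∃; _×_; _,_)
open import Data.Sum using (_⊎_)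
open import Data.Unit using (⊤)
open import Relation.Binary.PropositionalEquality using (_≡_; _≢_)

record Graph (n : ℕ) : Set where
  field
    adj     : Fin n → Fin n → Bool
    adj-sym : ∀ u v → adj u v ≡ adj v u
    loopless : ∀ v → adj v v ≡ false

open Graph public

Adj : ∀ {n} → Graph n → Fin n → Fin n → Set
Adj G u v = adj G u v ≡ true

data WalkIn {n} (G : Graph n) (P : Fin n → Set) : Fin n → Fin n → Set where
  here : ∀ {v} → P v → WalkIn G P v v
  step : ∀ {u w v} → P u → Adj G u w → WalkIn G P w v → WalkIn G P u v

InducesConnected : ∀ {n} → Graph n → (Fin n → Set) → Set
InducesConnected G P = ∀ u v → P u → P v → WalkIn G P u v

Connected : ∀ {n} → Graph n → Set
Connected G = ∀ u v → WalkIn G (λ _ → ⊤) u v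

record ProperColoring {n} (G : Graph n) (k : ℕ) : Set where
  field
    color    : Fin n → Fin k
    proper   : ∀ u v → Adj G u v → color u ≢ color v
    nonempty : ∀ (i : Fin k) → ∃ λ v → color v ≡ i

open ProperColoring public

RainbowCommittee : ∀ {n} {G : Graph n} {k} → ProperColoring G k → Set
RainbowCommittee {n} {k = k} c = Σ (Fin k → Fin n) λ pick → ∀ i → color c (pick i) ≡ i

InCommittee : ∀ {n} {G : Graph n} {k} {c : ProperColoring G k} →
              RainbowCommittee c → Fin n → Set
InCommittee {k = k} (pick , _) v = ∃ λ (i : Fin k) → pick i ≡ v

ConnectedCompelling : ∀ {n} {G : Graph n} {k} → ProperColoring G k → Set
ConnectedCompelling {G = G} c =
  ∀ (R : RainbowCommittee c) → InducesConnected G (InCommittee {c = c} R)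

IsMinimum : (ℕ → Set) → ℕ → Set
IsMinimum P m = P m × (∀ k → P k → m ≤ k)

IsChromaticNumber : ∀ {n} → Graph n → ℕ → Set
IsChromaticNumber G = IsMinimum (λ k → ProperColoring G k)

IsCCChromaticNumber : ∀ {n} → Graph n → ℕ → Set
IsCCChromaticNumber G =
  IsMinimum (λ k → Σ (ProperColoring G k) ConnectedCompelling)

Dominating : ∀ {n} → Graph n → Subset n → Set
Dominating G S = ∀ v → v ∈ S ⊎ ∃ λ u → u ∈ S × Adj G u v

ConnectedDominating : ∀ {n} → Graph n → Subset n → Set
ConnectedDominating G S = Dominating G S × InducesConnected G (_∈ S)

IsConnDomNumber : ∀ {n} → Graph n → ℕ → Set
IsConnDomNumber G = IsMinimum (λ k → ∃ λ S → ConnectedDominating G S × ∣ S ∣ ≡ k)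

{-# OPTIONS --safe #-}
module Submission where

-- Lower bound: in a connected-compelling coloring with k colors, one chosen
-- vertex per color forms a connected dominating set of size at most k.  It is
-- connected because it is a rainbow committee, and dominating because swapping
-- any vertex v into it gives another committee, in which v must have a
-- neighbour.  Upper bound: from a χ-coloring and a connected dominating set S,
-- give each vertex of S a color of its own; then every rainbow committee is S
-- plus vertices dominated by S, hence connected.

open import Defs
open import Data.Nat using (ℕ; _≤_; _⊔_; _+_; zero; suc; s≤s)
open import Data.Nat.Properties using (≤-trans; ⊔-lub)
open import Data.Product using (_×_; Σ; ∃; ∃₂; _,_; proj₁; proj₂)
open import Data.Sum using (inj₁; inj₂)
open import Data.Fin using (Fin; _≟_; _↑ˡ_; _↑ʳ_; splitAt) renaming (zero to fzero; suc to fsuc)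
open import Data.Fin.Properties using (any?; injective⇒≤; suc-injective; ↑ˡ-injective; ↑ʳ-injective; splitAt-↑ˡ; splitAt-↑ʳ)
open import Data.Fin.Subset using (Subset; _∈_; ∣_∣)
open import Data.Fin.Subset.Properties using (_∈?_; ∣p∣≤n)
open import Data.Vec using (_∷_; here; there; tabulate)
open import Data.Vec.Properties using (lookup∘tabulate; lookup⇒[]=; []=⇒lookup)
open import Data.Vec.Functional using (updateAt)
open import Data.Vec.Functional.Properties using (updateAt-updates; updateAt-minimal)
open import Data.Bool using (true; false)
open import Relation.Nullary using (Dec; yes; no; ¬_; does; contradiction)
open import Relation.Nullary.Decidable using (dec-true)
open import Relation.Binary.PropositionalEquality
  using (_≡_; _≢_; refl; sym; trans; cong; subst)

module _ {n} (G : Graph n) where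

  Adj-sym : ∀ {u v} → Adj G u v → Adj G v u
  Adj-sym {u} {v} a = trans (adj-sym G v u) a

  Adj-irrefl : ∀ {u} → ¬ Adj G u u
  Adj-irrefl {u} a with trans (sym a) (loopless G u)
  ... | ()

module _ {n} {G : Graph n} where

  mapWalk : ∀ {P Q : Fin n → Set} {u v} →
            (∀ {x} → P x → Q x) → WalkIn G P u v → WalkIn G Q u v
  mapWalk f (here p)     = here (f p)
  mapWalk f (step p a w) = step (f p) a (mapWalk f w)

  _++ʷ_ : ∀ {P : Fin n → Set} {u v w} → WalkIn G P u v → WalkIn G P v w → WalkIn G P u w
  here _     ++ʷ w′ = w′
  step p a w ++ʷ w′ = step p a (w ++ʷ w′)

  walk-start : ∀ {P : Fin n → Set} {u v} → WalkIn G P u v → P u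
  walk-start (here p)     = p
  walk-start (step p _ _) = p

  walk-firstStep : ∀ {P : Fin n → Set} {u v} → WalkIn G P u v → u ≢ v →
                   ∃ λ x → P x × Adj G u x
  walk-firstStep (here _)     u≢u = contradiction refl u≢u
  walk-firstStep (step _ a w) _   = _ , walk-start w , a

connected⇒edge : ∀ {n} (G : Graph n) → 2 ≤ n → Connected G → ∃₂ (Adj G)
connected⇒edge {suc (suc _)} G _ conn with walk-firstStep (conn fzero (fsuc fzero)) (λ ())
... | x , _ , a = fzero , x , a
connected⇒edge {suc zero} G (s≤s ()) _

module _ {n} {P : Fin n → Set} where

  subset : (∀ v → Dec (P v)) → Subset n
  subset P? = tabulate (λ v → does (P? v))

  ∈-subset⁺ : ∀ (P? : ∀ v → Dec (P v)) {v} → P v → v ∈ subset P?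
  ∈-subset⁺ P? {v} p = lookup⇒[]= v _ (trans (lookup∘tabulate _ v) (dec-true (P? v) p))

  ∈-subset⁻ : ∀ (P? : ∀ v → Dec (P v)) {v} → v ∈ subset P? → P v
  ∈-subset⁻ P? {v} v∈ with P? v | trans (sym (lookup∘tabulate _ v)) ([]=⇒lookup v∈)
  ... | yes p | _ = p
  ... | no _  | ()

nth : ∀ {n} (S : Subset n) → Fin ∣ S ∣ → Fin n
nth (true ∷ S)  fzero    = fzero
nth (true ∷ S)  (fsuc i) = fsuc (nth S i)
nth (false ∷ S) i        = fsuc (nth S i)

nth-∈ : ∀ {n} (S : Subset n) i → nth S i ∈ S
nth-∈ (true ∷ S)  fzero    = here
nth-∈ (true ∷ S)  (fsuc i) = there (nth-∈ S i)
nth-∈ (false ∷ S) i        = there (nth-∈ S i)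

nth-injective : ∀ {n} (S : Subset n) {i j} → nth S i ≡ nth S j → i ≡ j
nth-injective (true ∷ S)  {fzero}  {fzero}  _ = refl
nth-injective (true ∷ S)  {fsuc i} {fsuc j} e = cong fsuc (nth-injective S (suc-injective e))
nth-injective (false ∷ S)                   e = nth-injective S (suc-injective e)

index : ∀ {n} (S : Subset n) {v} → v ∈ S → Fin ∣ S ∣
index (true ∷ S)  {fzero}  here      = fzero
index (true ∷ S)  {fsuc v} (there p) = fsuc (index S p)
index (false ∷ S) {fsuc v} (there p) = index S p

nth-index : ∀ {n} (S : Subset n) {v} (p : v ∈ S) → nth S (index S p) ≡ v
nth-index (true ∷ S)  {fzero}  here      = refl
nth-index (true ∷ S)  {fsuc v} (there p) = cong fsuc (nth-index S p)
nth-index (false ∷ S) {fsuc v} (there p) = cong fsuc (nth-index S p)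

index-injective : ∀ {n} (S : Subset n) {u v} (p : u ∈ S) (q : v ∈ S) →
                  index S p ≡ index S q → u ≡ v
index-injective S p q e = trans (sym (nth-index S p)) (trans (cong (nth S) e) (nth-index S q))

injectiveOn⇒∣∣≤ : ∀ {n k} (S : Subset n) (f : Fin n → Fin k) →
                  (∀ {u v} → u ∈ S → v ∈ S → f u ≡ f v → u ≡ v) → ∣ S ∣ ≤ k
injectiveOn⇒∣∣≤ S f inj =
  injective⇒≤ (λ e → nth-injective S (inj (nth-∈ S _) (nth-∈ S _) e))

module _ {n} {G : Graph n} where

  -- Renumber the colors that actually occur, so that no class is empty.
  shrinkColoring : ∀ {K} (f : Fin n → Fin K) → (∀ u v → Adj G u v → f u ≢ f v) →
    Σ ℕ λ m → m ≤ K × Σ (ProperColoring G m) λ c →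
      ∀ {u v} → color c u ≡ color c v → f u ≡ f v
  shrinkColoring {K} f f-proper = ∣ I ∣ , ∣p∣≤n I , c , f-factors
    where
    occurs? : ∀ i → Dec (∃ λ x → f x ≡ i)
    occurs? i = any? (λ x → f x ≟ i)

    I : Subset K
    I = subset occurs?

    h : Fin n → Fin ∣ I ∣
    h x = index I (∈-subset⁺ occurs? (x , refl))

    f-factors : ∀ {u v} → h u ≡ h v → f u ≡ f v
    f-factors = index-injective I _ _

    h-surjective : ∀ j → ∃ λ x → h x ≡ j
    h-surjective j with ∈-subset⁻ occurs? (nth-∈ I j)
    ... | x , fx≡ = x , nth-injective I (trans (nth-index I _) fx≡)

    c : ProperColoring G ∣ I ∣
    c = record { color    = h
               ; proper   = λ u v a e → f-proper u v a (f-factors e)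
               ; nonempty = h-surjective }

  privateClasses⇒connectedCompelling :
    ∀ {k} (c : ProperColoring G k) (S : Subset n) → ConnectedDominating G S →
    (∀ {x s} → s ∈ S → color c x ≡ color c s → x ≡ s) → ConnectedCompelling c
  privateClasses⇒connectedCompelling c S (dom , S-conn) private-class R@(pick , pick-color) = connected
    where
    InR : Fin n → Set
    InR = InCommittee {c = c} R

    S⊆R : ∀ {s} → s ∈ S → InR s
    S⊆R {s} s∈S = color c s , private-class s∈S (pick-color (color c s))

    to-S : ∀ {u} → InR u → ∃ λ w → w ∈ S × WalkIn G InR u w
    to-S {u} u∈R with dom u
    ... | inj₁ u∈S           = u , u∈S , here u∈R
    ... | inj₂ (w , w∈S , a) = w , w∈S , step u∈R (Adj-sym G a) (here (S⊆R w∈S))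

    from-S : ∀ {v} → InR v → ∃ λ w → w ∈ S × WalkIn G InR w v
    from-S {v} v∈R with dom v
    ... | inj₁ v∈S           = v , v∈S , here v∈R
    ... | inj₂ (w , w∈S , a) = w , w∈S , step (S⊆R w∈S) a (here v∈R)

    connected : InducesConnected G InR
    connected u v u∈R v∈R with to-S u∈R | from-S v∈R
    ... | w , w∈S , u⇝w | w′ , w′∈S , w′⇝v = u⇝w ++ʷ (mapWalk S⊆R (S-conn w w′ w∈S w′∈S) ++ʷ w′⇝v)

edge⇒anotherColor : ∀ {n} {G : Graph n} {k} (c : ProperColoring G k) → ∃₂ (Adj G) →
                    ∀ i → ∃ λ j → j ≢ i
edge⇒anotherColor c (a , b , ab) i with color c a ≟ i
... | yes ca≡i = color c b , λ cb≡i → proper c a b ab (trans ca≡i (sym cb≡i))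
... | no ca≢i  = color c a , ca≢i

↑ˡ≢↑ʳ : ∀ {m n} (i : Fin m) (j : Fin n) → i ↑ˡ n ≢ m ↑ʳ j
↑ˡ≢↑ʳ {m} {n} i j e with trans (sym (splitAt-↑ˡ m i n)) (trans (cong (splitAt m) e) (splitAt-↑ʳ m n j))
... | ()

module _ {n} {G : Graph n} where

  upperBound : ∀ {χ} → ProperColoring G χ → (S : Subset n) → ConnectedDominating G S →
    Σ ℕ λ m → m ≤ χ + ∣ S ∣ × Σ (ProperColoring G m) ConnectedCompelling
  upperBound {χ} c S cds =
    let m , m≤ , c′ , factors = shrinkColoring recolor recolor-proper
    in m , m≤ , c′ ,
       privateClasses⇒connectedCompelling c′ S cds (λ s∈S e → recolor-private s∈S (factors e))
    where
    recolor : Fin n → Fin (χ + ∣ S ∣)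
    recolor v with v ∈? S
    ... | yes v∈S = χ ↑ʳ index S v∈S
    ... | no _    = color c v ↑ˡ ∣ S ∣

    recolor-proper : ∀ u v → Adj G u v → recolor u ≢ recolor v
    recolor-proper u v a with u ∈? S | v ∈? S
    ... | yes u∈S | yes v∈S = λ e →
      Adj-irrefl G (subst (Adj G u) (sym (index-injective S u∈S v∈S (↑ʳ-injective χ _ _ e))) a)
    ... | yes _   | no _    = λ e → ↑ˡ≢↑ʳ _ _ (sym e)
    ... | no _    | yes _   = ↑ˡ≢↑ʳ _ _
    ... | no _    | no _    = λ e → proper c u v a (↑ˡ-injective ∣ S ∣ _ _ e)

    recolor-private : ∀ {x s} → s ∈ S → recolor x ≡ recolor s → x ≡ s
    recolor-private {x} {s} s∈S e with x ∈? S | s ∈? S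
    ... | _       | no s∉S   = contradiction s∈S s∉S
    ... | yes x∈S | yes s∈S′ = index-injective S x∈S s∈S′ (↑ʳ-injective χ _ _ e)
    ... | no _    | yes _    = contradiction e (↑ˡ≢↑ʳ _ _)

module LowerBound {n} {G : Graph n} (edge : ∃₂ (Adj G))
                  {k} (c : ProperColoring G k) (cc : ConnectedCompelling c) where

  representative : Fin k → Fin n
  representative i = proj₁ (nonempty c i)

  representative-color : ∀ i → color c (representative i) ≡ i
  representative-color i = proj₂ (nonempty c i)

  isRepresentative? : ∀ v → Dec (representative (color c v) ≡ v)
  isRepresentative? v = representative (color c v) ≟ v

  S : Subset n
  S = subset isRepresentative?

  representative-∈ : ∀ i → representative i ∈ S
  representative-∈ i = ∈-subset⁺ isRepresentative? (cong representative (representative-color i))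

  representatives : RainbowCommittee c
  representatives = representative , representative-color

  swapPick : Fin n → Fin k → Fin n
  swapPick v = updateAt representative (color c v) (λ _ → v)

  swapPick-color : ∀ v i → color c (swapPick v i) ≡ i
  swapPick-color v i with i ≟ color c v
  ... | yes refl = cong (color c) (updateAt-updates (color c v) representative)
  ... | no i≢cv  = trans (cong (color c) (updateAt-minimal i (color c v) representative i≢cv))
                         (representative-color i)

  swapPick-other : ∀ v i → swapPick v i ≢ v → swapPick v i ≡ representative i
  swapPick-other v i ne with i ≟ color c v
  ... | yes refl = contradiction (updateAt-updates (color c v) representative) ne
  ... | no i≢cv  = updateAt-minimal i (color c v) representative i≢cv

  S-connected : InducesConnected G (_∈ S)
  S-connected u v u∈S v∈S =
    mapWalk (λ { (i , refl) → representative-∈ i })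
      (cc representatives u v (color c u , ∈-subset⁻ isRepresentative? u∈S)
                              (color c v , ∈-subset⁻ isRepresentative? v∈S))

  -- The committee with v swapped in is connected and has a second member, so v
  -- has a neighbour in it, which (being ≠ v) is a representative.
  S-dominating : Dominating G S
  S-dominating v with edge⇒anotherColor c edge (color c v)
  ... | j , j≢cv with walk-firstStep (cc (swapPick v , swapPick-color v) v (swapPick v j)
                                         (color c v , updateAt-updates (color c v) representative)
                                         (j , refl))
                                     (λ e → j≢cv (trans (sym (swapPick-color v j)) (cong (color c) (sym e))))
  ... | _ , (i , refl) , a =
    inj₂ (_ , subst (_∈ S) (sym (swapPick-other v i (λ e → Adj-irrefl G (subst (Adj G v) e a))))
                           (representative-∈ i)
            , Adj-sym G a)

  ∣S∣≤k : ∣ S ∣ ≤ k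
  ∣S∣≤k = injectiveOn⇒∣∣≤ S (color c) λ u∈S v∈S e →
    trans (sym (∈-subset⁻ isRepresentative? u∈S))
          (trans (cong representative e) (∈-subset⁻ isRepresentative? v∈S))

lowerBound : ∀ {n} {G : Graph n} → ∃₂ (Adj G) → ∀ {k} (c : ProperColoring G k) →
             ConnectedCompelling c → ∃ λ S → ConnectedDominating G S × ∣ S ∣ ≤ k
lowerBound edge c cc = S , (S-dominating , S-connected) , ∣S∣≤k
  where open LowerBound edge c cc

mainTheorem13 : ∀ (n : ℕ) (G : Graph n) → 2 ≤ n → Connected G →
    ∀ (ccc χ γc : ℕ) → IsCCChromaticNumber G ccc → IsChromaticNumber G χ →
    IsConnDomNumber G γc → (χ ⊔ γc ≤ ccc) × (ccc ≤ χ + γc)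
mainTheorem13 _ G 2≤n conn ccc χ γc ((c , c-compelling) , ccc-min) (c-χ , χ-min)
              ((S , S-cds , ∣S∣≡γc) , γc-min)
  with lowerBound (connected⇒edge G 2≤n conn) c c-compelling | upperBound c-χ S S-cds
... | S′ , S′-cds , ∣S′∣≤ccc | m , m≤χ+∣S∣ , c′ , c′-compelling =
  ⊔-lub (χ-min ccc c) (≤-trans (γc-min ∣ S′ ∣ (S′ , S′-cds , refl)) ∣S′∣≤ccc) ,
  ≤-trans (ccc-min m (c′ , c′-compelling)) (subst (λ t → m ≤ χ + t) ∣S∣≡γc m≤χ+∣S∣)
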